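{- Let $g\ge 1$ and let $T=(V,A,E)$ be a tree compression of the rook graph $\mathbf{R}_{g\times g}$. Then the number $|E|$ of compression edges is at least $g^3/32-g^2$.
   Context: The rook graph is the directed graph $\mathbf{R}_{g\times g}=(\mathbf{V},\mathbf{E})$ with $\mathbf{V}=\{1,\dots,g\}\times\{1,\dots,g\}$ and $\mathbf{E}=\{((r_1,c_1),(r_2,c_2))\mid r_1=r_2 \text{ or } c_1=c_2\}$ (in particular it contains all loops). A DAG compression of a directed graph $(\mathbf{V},\mathbf{E})$ is a triple $(V,A,E)$ where $(V,A)$ is a directed acyclic graph whose set of sinks (vertices of out-degree $0$) is exactly $\mathbf{V}\subseteq V$; for $v\in V$ the cluster $\mathbf{C}(v)$ is the set of sinks reachable from $v$ in $(V,A)$; and $E\subseteq V\times V$ is a set of compression edges with $\mathbf{E}=\bigcup_{(u,v)\in E}\mathbf{C}(u)\times\mathbf{C}(v)$. A tree compression is a DAG compression in which $(V,A)$ is a (rooted, directed) tree, i.e. there is a root from which every vertex is reached by a unique path. -}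

module Defs where

open import Data.Nat using (ℕ)
open import Data.Fin using (Fin)
open import Data.Bool using (Bool; T)
open import Data.Product using (_×_; _,_; proj₁; proj₂; Σ; ∃)
open import Data.Sum using (_⊎_; inj₁; inj₂)
open import Data.Empty using (⊥)
open import Data.List using (List; length)
open import Data.List.Membership.Propositional using (_∈_)
open import Data.List.Relation.Unary.Unique.Propositional using (Unique)
open import Relation.Nullary using (¬_)
open import Relation.Binary.PropositionalEquality using (_≡_)
open import Relation.Binary.Construct.Closure.ReflexiveTransitive using (Star; ε; _◅_)
open import Relation.Binary.Construct.Closure.Transitive using (TransClosure)

-- Vertex set 𝐕 = {1..g} × {1..g} of the rook graph (0-indexed).
Square : ℕ → Set
Square g = Fin g × Fin g

-- Edge relation of the rook graph R_{g×g} (contains all loops).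
RookEdge : ∀ {g} → Square g → Square g → Set
RookEdge p q = (proj₁ p ≡ proj₁ q) ⊎ (proj₂ p ≡ proj₂ q)

-- The vertex set of the tree is
-- V = 𝐕 ⊎ Fin m : the vertices of the rook graph (inj₁) together with
-- m further vertices (inj₂).
record TreeCompression (g : ℕ) : Set where
  field
    m    : ℕ
  Vert : Set
  Vert = Square g ⊎ Fin m
  field
    arc  : Vert → Vert → Bool
  Arc : Vert → Vert → Set
  Arc u v = T (arc u v)
  Path : Vert → Vert → Set
  Path = Star Arc
  -- cluster 𝐂(v): the sinks reachable from v
  InCluster : Square g → Vert → Set
  InCluster x v = Path v (inj₁ x)
  field
    acyclic   : ∀ v → ¬ TransClosure Arc v v
    -- the set of sinks is exactly 𝐕
    sinks-𝐕   : ∀ x w → ¬ Arc (inj₁ x) w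
    nonsinks  : ∀ i → ∃ λ w → Arc (inj₂ i) w
    root      : Vert
    reach     : ∀ v → Path root v
    uniquePath : ∀ v (p q : Path root v) → p ≡ q
    E         : List (Vert × Vert)
    E-unique  : Unique E
    -- 𝐄 = ⋃_{(u,v) ∈ E} 𝐂(u) × 𝐂(v)
    covers    : ∀ p q → RookEdge p q →
                Σ (Vert × Vert) λ e → e ∈ E × InCluster p (proj₁ e) × InCluster q (proj₂ e)
    sound     : ∀ u v → (u , v) ∈ E → ∀ p q →
                InCluster p u → InCluster q v → RookEdge p q

numEdges : ∀ {g} → TreeCompression g → ℕ
numEdges T = length (TreeCompression.E T)

module Submission where

-- Clusters of a tree compression are laminar: two clusters sharing a square are nested,
-- because the unique path from the root to that square passes through both vertices.
-- Hence every square p is isolated in its row or in its column, i.e. every cluster through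
-- p lying inside that line is {p}: if some cluster through p inside its column has a second
-- square, every cluster through p inside its row is nested with it, hence equal to {p}.
--
-- Assign to each square a direction in which it is isolated. On each line c of a fixed
-- direction, let a_c count the squares of c assigned to that direction. Every ordered
-- pair (p, q) of such squares on a common line is covered by an edge (u, v) of E. If 𝐂(u)
-- leaves the line, q lies in the position of any square of 𝐂(u) off the line, and by
-- laminarity this does not depend on the edge, so p determines q; symmetrically if 𝐂(v)
-- leaves the line. Otherwise 𝐂(u) = {p} and 𝐂(v) = {q}, so the edge determines the pair.
-- Thus Σ a_c² ≤ |E| + 2g² in each direction, whereas the a_c of both directions add up
-- to g². Summing 4ga ≤ 4a² + g² over all 2g lines gives g³ ≤ 4|E| + 8g².

open import Defs
open import Data.Nat using (ℕ; zero; suc; _+_; _*_; _^_; _≤_; z≤n)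
open import Data.Nat.Properties
  using ( +-0-commutativeMonoid; +-*-semiring; +-comm; *-comm; *-identityʳ; ≤-total; ≤-trans
        ; m≤m+n; m≤n⇒∃[o]m+o≡n; +-mono-≤; +-monoˡ-≤; *-monoʳ-≤; +-cancelʳ-≤; *-cancelˡ-≤
        ; module ≤-Reasoning )
open import Data.Nat.Tactic.RingSolver using (solve-∀)
open import Data.Fin using (Fin; zero; suc; _↑ˡ_; _↑ʳ_; splitAt; join)
import Data.Fin.Properties as Fin
open import Data.Fin.Properties using (join-splitAt; injective⇒≤; *↔×; +↔⊎) renaming (_≟_ to _≟ᶠ_)
open import Data.Product using (Σ; ∃; _×_; _,_; proj₁; proj₂; map)
import Data.Product.Properties as Product
open import Data.Product.Function.Dependent.Propositional using (congˡ)
open import Data.Sum using (_⊎_; inj₁; inj₂)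
import Data.Sum as Sum
import Data.Sum.Properties as Sum
open import Data.Sum.Function.Propositional using (_⊎-↔_)
open import Data.List using (List; []; _∷_; length; lookup)
open import Data.List.Relation.Unary.Any using (here; there; any?; index)
open import Data.List.Relation.Unary.Any.Properties using (lookup-index)
open import Data.List.Membership.Propositional using (_∈_; find; lose)
import Data.List.Membership.DecPropositional as DecMembership
open import Function using (_∘_; id; case_of_; _↣_; _↔_; Injection; mk↣)
open import Function.Construct.Composition using (_↣-∘_; _↔-∘_)
open import Function.Properties.Inverse using (↔⇒↣; ↔-sym; ↔-refl)
open import Function.Related.Propositional using (injection)
open import Relation.Nullary using (Dec; yes; no; contradiction; ¬?; _×-dec_)
open import Relation.Nullary.Decidable using (map′; decidable-stable)
open import Relation.Unary using (Pred; Decidable)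
open import Relation.Binary using (Rel; DecidableEquality)
open import Relation.Binary.PropositionalEquality
open import Relation.Binary.Construct.Closure.ReflexiveTransitive using (Star; ε; _◅_; _◅◅_)
open import Algebra.Properties.CommutativeMonoid.Sum +-0-commutativeMonoid
  using (sum; sum-syntax; ∑-distrib-+; ∑-comm; sum-cong-≗)
open import Algebra.Properties.Semiring.Sum +-*-semiring using (*-distribˡ-sum)

↣⇒≤ : ∀ {m n} → Fin m ↣ Fin n → m ≤ n
↣⇒≤ f = injective⇒≤ (Injection.injective f)

∑-const : ∀ n k → ∑[ i < n ] k ≡ n * k
∑-const zero    k = refl
∑-const (suc n) k = cong (k +_) (∑-const n k)

∑-mono-≤ : ∀ {n} {f h : Fin n → ℕ} → (∀ i → f i ≤ h i) → sum f ≤ sum h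
∑-mono-≤ {zero}  f≤h = z≤n
∑-mono-≤ {suc n} f≤h = +-mono-≤ (f≤h zero) (∑-mono-≤ (f≤h ∘ suc))

∑-decode : ∀ {n} (f : Fin n → ℕ) → Fin (sum f) → Σ (Fin n) (Fin ∘ f)
∑-decode {suc n} f k with splitAt (f zero) k
... | inj₁ a = zero , a
... | inj₂ b = map suc id (∑-decode (f ∘ suc) b)

∑-encode : ∀ {n} (f : Fin n → ℕ) → Σ (Fin n) (Fin ∘ f) → Fin (sum f)
∑-encode {suc n} f (zero  , a) = a ↑ˡ sum (f ∘ suc)
∑-encode {suc n} f (suc i , a) = f zero ↑ʳ ∑-encode (f ∘ suc) (i , a)

∑-encode-decode : ∀ {n} (f : Fin n → ℕ) k → ∑-encode f (∑-decode f k) ≡ k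
∑-encode-decode {suc n} f k with splitAt (f zero) k in eq
... | inj₁ a = trans (cong (join (f zero) _) (sym eq)) (join-splitAt (f zero) _ k)
... | inj₂ b = begin
  f zero ↑ʳ ∑-encode (f ∘ suc) (∑-decode (f ∘ suc) b) ≡⟨ cong (f zero ↑ʳ_) (∑-encode-decode (f ∘ suc) b) ⟩
  join (f zero) _ (inj₂ b)                             ≡⟨ cong (join (f zero) _) eq ⟨
  join (f zero) _ (splitAt (f zero) k)                 ≡⟨ join-splitAt (f zero) _ k ⟩
  k                                                    ∎
  where open ≡-Reasoning

∑↣Σ : ∀ {n} (f : Fin n → ℕ) → Fin (sum f) ↣ Σ (Fin n) (Fin ∘ f)
∑↣Σ f = mk↣ λ {k} {k'} eq → begin
  k                           ≡⟨ ∑-encode-decode f k ⟨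
  ∑-encode f (∑-decode f k)   ≡⟨ cong (∑-encode f) eq ⟩
  ∑-encode f (∑-decode f k')  ≡⟨ ∑-encode-decode f k' ⟩
  k'                          ∎
  where open ≡-Reasoning

indicator : ∀ {a} {A : Set a} → Dec A → ℕ
indicator (yes _) = 1
indicator (no _)  = 0

indicator-witness : ∀ {a} {A : Set a} (a? : Dec A) → Fin (indicator a?) → A
indicator-witness (yes a) _ = a

indicator-unique : ∀ {a} {A : Set a} (a? : Dec A) (x y : Fin (indicator a?)) → x ≡ y
indicator-unique (yes _) zero zero = refl

module _ {n p} {P : Pred (Fin n) p} (P? : Decidable P) where

  count : ℕ
  count = ∑[ i < n ] indicator (P? i)

  select : Fin count → Fin n
  select = proj₁ ∘ ∑-decode (indicator ∘ P?)

  select-satisfies : ∀ k → P (select k)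
  select-satisfies k with i , a ← ∑-decode (indicator ∘ P?) k = indicator-witness (P? i) a

  select-injective : ∀ {k k'} → select k ≡ select k' → k ≡ k'
  select-injective {k} {k'} eq = Injection.injective (∑↣Σ (indicator ∘ P?))
    (Product.Σ-≡,≡→≡ (eq , indicator-unique (P? (select k')) _ _))

count-partition : ∀ {n p q} {P : Pred (Fin n) p} {Q : Pred (Fin n) q} (P? : Decidable P) (Q? : Decidable Q) →
                  (∀ i → indicator (P? i) + indicator (Q? i) ≡ 1) → count P? + count Q? ≡ n
count-partition {n} P? Q? exactly-one = begin
  count P? + count Q?                               ≡⟨ ∑-distrib-+ (indicator ∘ P?) (indicator ∘ Q?) ⟨
  ∑[ i < n ] (indicator (P? i) + indicator (Q? i))  ≡⟨ sum-cong-≗ exactly-one ⟩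
  ∑[ i < n ] 1                                      ≡⟨ ∑-const n 1 ⟩
  n * 1                                             ≡⟨ *-identityʳ n ⟩
  n                                                 ∎
  where open ≡-Reasoning

2xy≤x²+y²-ordered : ∀ {x y} → x ≤ y → 2 * (x * y) ≤ x * x + y * y
2xy≤x²+y²-ordered {x} x≤y with d , refl ← m≤n⇒∃[o]m+o≡n x≤y =
  subst (2 * (x * (x + d)) ≤_) (expand x d) (m≤m+n _ (d * d))
  where
  expand : ∀ x d → 2 * (x * (x + d)) + d * d ≡ x * x + (x + d) * (x + d)
  expand = solve-∀

2xy≤x²+y² : ∀ x y → 2 * (x * y) ≤ x * x + y * y
2xy≤x²+y² x y with ≤-total x y
... | inj₁ x≤y = 2xy≤x²+y²-ordered x≤y
... | inj₂ y≤x = subst₂ _≤_ (cong (2 *_) (*-comm y x)) (+-comm (y * y) (x * x)) (2xy≤x²+y²-ordered y≤x)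

4ma≤4a²+m² : ∀ m a → 4 * (m * a) ≤ 4 * (a * a) + m * m
4ma≤4a²+m² m a = subst₂ _≤_ (regroup m a) (square-2a m a) (2xy≤x²+y² (2 * a) m)
  where
  regroup : ∀ m a → 2 * ((2 * a) * m) ≡ 4 * (m * a)
  regroup = solve-∀
  square-2a : ∀ m a → (2 * a) * (2 * a) + m * m ≡ 4 * (a * a) + m * m
  square-2a = solve-∀

∑-4ma≤4a²+m² : ∀ {n} m (a : Fin n → ℕ) → 4 * (m * sum a) ≤ 4 * ∑[ i < n ] (a i * a i) + n * (m * m)
∑-4ma≤4a²+m² {n} m a = begin
  4 * (m * sum a)                                    ≡⟨ cong (4 *_) (*-distribˡ-sum m a) ⟩
  4 * ∑[ i < n ] (m * a i)                           ≡⟨ *-distribˡ-sum 4 (λ i → m * a i) ⟩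
  ∑[ i < n ] (4 * (m * a i))                         ≤⟨ ∑-mono-≤ (λ i → 4ma≤4a²+m² m (a i)) ⟩
  ∑[ i < n ] (4 * (a i * a i) + m * m)               ≡⟨ ∑-distrib-+ (λ i → 4 * (a i * a i)) (λ _ → m * m) ⟩
  ∑[ i < n ] (4 * (a i * a i)) + ∑[ i < n ] (m * m)  ≡⟨ cong₂ _+_ (sym (*-distribˡ-sum 4 (λ i → a i * a i))) (∑-const n (m * m)) ⟩
  4 * ∑[ i < n ] (a i * a i) + n * (m * m)           ∎
  where open ≤-Reasoning

g³≤4K : ∀ g K S T → S + T ≡ g * g →
        4 * (g * S) ≤ 4 * K + g * (g * g) → 4 * (g * T) ≤ 4 * K + g * (g * g) → g ^ 3 ≤ 4 * K
g³≤4K g K S T S+T≡g² S-bound T-bound =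
  subst (_≤ 4 * K) (cong (λ x → g * (g * x)) (sym (*-identityʳ g)))
    (*-cancelˡ-≤ 2 (+-cancelʳ-≤ (2 * G³) (2 * G³) (2 * (4 * K)) doubled))
  where
  open ≤-Reasoning
  G³ = g * (g * g)
  twice : ∀ x → 4 * x ≡ 2 * x + 2 * x
  twice = solve-∀
  split : ∀ g S T → 4 * (g * (S + T)) ≡ 4 * (g * S) + 4 * (g * T)
  split = solve-∀
  regroup : ∀ B X → (B + X) + (B + X) ≡ 2 * B + 2 * X
  regroup = solve-∀
  doubled : 2 * G³ + 2 * G³ ≤ 2 * (4 * K) + 2 * G³
  doubled = begin
    2 * G³ + 2 * G³                       ≡⟨ twice G³ ⟨
    4 * (g * (g * g))                     ≡⟨ cong (λ s → 4 * (g * s)) S+T≡g² ⟨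
    4 * (g * (S + T))                     ≡⟨ split g S T ⟩
    4 * (g * S) + 4 * (g * T)             ≤⟨ +-mono-≤ S-bound T-bound ⟩
    (4 * K + G³) + (4 * K + G³)           ≡⟨ regroup (4 * K) G³ ⟩
    2 * (4 * K) + 2 * G³                  ∎

4[L+2g²]≤32L+32g² : ∀ L g → 4 * (L + (g * g + g * g)) ≤ 32 * L + 32 * g ^ 2
4[L+2g²]≤32L+32g² L g = begin
  4 * (L + (g * g + g * g))                            ≤⟨ m≤m+n _ (28 * L + 24 * (g * g)) ⟩
  4 * (L + (g * g + g * g)) + (28 * L + 24 * (g * g))  ≡⟨ expand L (g * g) ⟩
  32 * L + 32 * (g * g)                                ≡⟨ cong (λ x → 32 * L + 32 * (g * x)) (*-identityʳ g) ⟨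
  32 * L + 32 * g ^ 2                                  ∎
  where
  open ≤-Reasoning
  expand : ∀ L G → 4 * (L + (G + G)) + (28 * L + 24 * G) ≡ 32 * L + 32 * G
  expand = solve-∀

module _ {a ℓ} {A : Set a} {R : Rel A ℓ} where

  vertices : ∀ {x y} → Star R x y → List A
  vertices {x} ε       = x ∷ []
  vertices {x} (_ ◅ s) = x ∷ vertices s

  drop-until : ∀ {x y v} (s : Star R x y) → v ∈ vertices s → Star R v y
  drop-until ε       (here refl)  = ε
  drop-until (r ◅ s) (here refl)  = r ◅ s
  drop-until (r ◅ s) (there v∈s) = drop-until s v∈s

  ∈-vertices-◅◅ : ∀ {x v y} (s : Star R x v) (t : Star R v y) → v ∈ vertices (s ◅◅ t)
  ∈-vertices-◅◅ ε       ε       = here refl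
  ∈-vertices-◅◅ ε       (_ ◅ _) = here refl
  ∈-vertices-◅◅ (_ ◅ s) t       = there (∈-vertices-◅◅ s t)

  ◅-injective : ∀ {x u u' y} {r : R x u} {r' : R x u'} {s : Star R u y} {s' : Star R u' y} →
                _≡_ {A = Star R x y} (r ◅ s) (r' ◅ s') → Σ (u ≡ u') λ { refl → s ≡ s' }
  ◅-injective refl = refl , refl

  ◅◅-comparable : ∀ {x u u' y} (s : Star R x u) (t : Star R u y) (s' : Star R x u') (t' : Star R u' y) →
                  s ◅◅ t ≡ s' ◅◅ t' → Star R u u' ⊎ Star R u' u
  ◅◅-comparable ε       _ s'        _  _  = inj₁ s'
  ◅◅-comparable (r ◅ s) _ ε         _  _  = inj₂ (r ◅ s)
  ◅◅-comparable (r ◅ s) t (r' ◅ s') t' eq with refl , eq' ← ◅-injective eq = ◅◅-comparable s t s' t' eq'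

∈-index-injective : ∀ {a} {A : Set a} {xs : List A} {x y} (x∈xs : x ∈ xs) (y∈xs : y ∈ xs) →
                    index x∈xs ≡ index y∈xs → x ≡ y
∈-index-injective {xs = xs} x∈xs y∈xs eq =
  trans (lookup-index x∈xs) (trans (cong (lookup xs) eq) (sym (lookup-index y∈xs)))

data Direction : Set where
  row col : Direction

_≟ᵈ_ : DecidableEquality Direction
row ≟ᵈ row = yes refl
row ≟ᵈ col = no λ ()
col ≟ᵈ row = no λ ()
col ≟ᵈ col = yes refl

indicator-row+col : ∀ d → indicator (d ≟ᵈ row) + indicator (d ≟ᵈ col) ≡ 1
indicator-row+col row = refl
indicator-row+col col = refl

module _ {g : ℕ} where

  line pos : Direction → Square g → Fin g
  line row = proj₁
  line col = proj₂
  pos  row = proj₂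
  pos  col = proj₁

  point : Direction → Fin g → Fin g → Square g
  point row c i = c , i
  point col c i = i , c

  point-collinear : ∀ d c i j → line d (point d c i) ≡ line d (point d c j)
  point-collinear row c i j = refl
  point-collinear col c i j = refl

  point-injective : ∀ d {c c' i i'} → point d c i ≡ point d c' i' → c ≡ c' × i ≡ i'
  point-injective row refl = refl , refl
  point-injective col refl = refl , refl

  line-pos-injective : ∀ d {p q : Square g} → line d p ≡ line d q → pos d p ≡ pos d q → p ≡ q
  line-pos-injective row refl refl = refl
  line-pos-injective col refl refl = refl

  same-line⇒rook : ∀ d {p q : Square g} → line d p ≡ line d q → RookEdge p q
  same-line⇒rook row = inj₁
  same-line⇒rook col = inj₂

  rook⇒same-pos : ∀ d {p q : Square g} → RookEdge p q → line d p ≢ line d q → pos d p ≡ pos d q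
  rook⇒same-pos row (inj₁ eq) ne = contradiction eq ne
  rook⇒same-pos row (inj₂ eq) _  = eq
  rook⇒same-pos col (inj₁ eq) _  = eq
  rook⇒same-pos col (inj₂ eq) ne = contradiction eq ne

  rook-sym : {p q : Square g} → RookEdge p q → RookEdge q p
  rook-sym = Sum.map sym sym

  _≟ˢ_ : DecidableEquality (Square g)
  _≟ˢ_ = Product.≡-dec _≟ᶠ_ _≟ᶠ_

  ∃-square? : ∀ {p} {P : Pred (Square g) p} → Decidable P → Dec (∃ P)
  ∃-square? P? = map′ (λ (i , j , p) → (i , j) , p) (λ ((i , j) , p) → i , j , p)
                      (Fin.any? λ i → Fin.any? λ j → P? (i , j))

module Clusters {g : ℕ} (T : TreeCompression g) where

  open TreeCompression T

  _≟ᵛ_ : DecidableEquality Vert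
  _≟ᵛ_ = Sum.≡-dec _≟ˢ_ _≟ᶠ_

  open DecMembership _≟ᵛ_ using (_∈?_)

  _⊆ᶜ_ : Vert → Vert → Set
  u ⊆ᶜ w = ∀ {x} → InCluster x u → InCluster x w

  path⇒⊇ᶜ : ∀ {u w} → Path u w → w ⊆ᶜ u
  path⇒⊇ᶜ u→w x∈w = u→w ◅◅ x∈w

  ancestors : Square g → List Vert
  ancestors x = vertices (reach (inj₁ x))

  ∈-ancestors⇒InCluster : ∀ {x w} → w ∈ ancestors x → InCluster x w
  ∈-ancestors⇒InCluster = drop-until _

  InCluster⇒∈-ancestors : ∀ {x w} → InCluster x w → w ∈ ancestors x
  InCluster⇒∈-ancestors {x} {w} x∈w =
    subst (λ s → w ∈ vertices s) (uniquePath _ (reach w ◅◅ x∈w) (reach (inj₁ x))) (∈-vertices-◅◅ (reach w) x∈w)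

  inCluster? : ∀ x w → Dec (InCluster x w)
  inCluster? x w = map′ ∈-ancestors⇒InCluster InCluster⇒∈-ancestors (w ∈? ancestors x)

  ∃-cluster? : ∀ {q} {Q : Pred Vert q} → Decidable Q → ∀ x → Dec (∃ λ w → InCluster x w × Q w)
  ∃-cluster? Q? x = map′
    (λ any → let w , w∈ , Qw = find any in w , ∈-ancestors⇒InCluster w∈ , Qw)
    (λ (w , x∈w , Qw) → lose (InCluster⇒∈-ancestors x∈w) Qw)
    (any? Q? (ancestors x))

  clusters-nested : ∀ {x u w} → InCluster x u → InCluster x w → u ⊆ᶜ w ⊎ w ⊆ᶜ u
  clusters-nested {x} {u} {w} x∈u x∈w =
    Sum.swap (Sum.map path⇒⊇ᶜ path⇒⊇ᶜ (◅◅-comparable (reach u) x∈u (reach w) x∈w (uniquePath _ _ _)))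

  WithinLine LeavesLine : Direction → Vert → Fin g → Set
  WithinLine d w c = ∀ {x} → InCluster x w → line d x ≡ c
  LeavesLine d w c = ∃ λ x → InCluster x w × line d x ≢ c

  within-or-leaves : ∀ d w c → WithinLine d w c ⊎ LeavesLine d w c
  within-or-leaves d w c with ∃-square? (λ x → inCluster? x w ×-dec ¬? (line d x ≟ᶠ c))
  ... | yes leaves = inj₂ leaves
  ... | no ¬leaves = inj₁ λ {x} x∈w → decidable-stable (line d x ≟ᶠ c) λ x∉c → ¬leaves (x , x∈w , x∉c)

  withinLine? : ∀ d w c → Dec (WithinLine d w c)
  withinLine? d w c with within-or-leaves d w c
  ... | inj₁ within            = yes within
  ... | inj₂ (x , x∈w , x∉c) = no λ within → x∉c (within x∈w)

  Isolated : Direction → Square g → Set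
  Isolated d p = ∀ {w} → InCluster p w → WithinLine d w (line d p) → ∀ {z} → InCluster z w → z ≡ p

  isolated-direction : ∀ p → Σ Direction λ d → Isolated d p
  isolated-direction p with ∃-cluster? spread? p
    where
    spread? : ∀ w → Dec (WithinLine col w (line col p) × ∃ λ z → InCluster z w × z ≢ p)
    spread? w = withinLine? col w (line col p) ×-dec ∃-square? λ z → inCluster? z w ×-dec ¬? (z ≟ˢ p)
  ... | no ¬spread = col , λ {w} p∈w within {z} z∈w →
    decidable-stable (z ≟ˢ p) λ z≢p → ¬spread (w , p∈w , within , z , z∈w , z≢p)
  ... | yes (w , p∈w , within , z , z∈w , z≢p) = row , λ p∈w' within' z'∈w' →
    case clusters-nested p∈w p∈w' of λ where
      (inj₁ w⊆w') → contradiction (line-pos-injective row (within' (w⊆w' z∈w)) (within z∈w)) z≢p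
      (inj₂ w'⊆w) → line-pos-injective row (within' z'∈w') (within (w'⊆w z'∈w'))

module Covering {g : ℕ} (T : TreeCompression g) where

  open TreeCompression T
  open Clusters T

  Linked : Vert → Vert → Set
  Linked u v = ∀ {a b} → InCluster a u → InCluster b v → RookEdge a b

  edge-linked : ∀ {u v} → (u , v) ∈ E → Linked u v
  edge-linked {u} {v} uv∈E a∈u b∈v = sound u v uv∈E _ _ a∈u b∈v

  linked-sym : ∀ {u v} → Linked u v → Linked v u
  linked-sym link b∈v a∈u = rook-sym (link a∈u b∈v)

  linked-off-line : ∀ d {u w p y c} → Linked u w → InCluster p u → InCluster y w →
                    line d p ≡ c → line d y ≢ c → pos d p ≡ pos d y
  linked-off-line d link p∈u y∈w p∈c y∉c = rook⇒same-pos d (link p∈u y∈w) λ eq → y∉c (trans (sym eq) p∈c)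

  leaving-determines : ∀ d {u w u' w' p p' q} → Linked u w → Linked u' w' →
                 InCluster p u → InCluster p' u' → InCluster q w → InCluster q w' →
                 line d p ≡ line d q → line d p' ≡ line d q →
                 LeavesLine d w (line d q) → LeavesLine d w' (line d q) → p ≡ p'
  leaving-determines d link link' p∈u p'∈u' q∈w q∈w' p∈ℓ p'∈ℓ (y , y∈w , y∉ℓ) (y' , y'∈w' , y'∉ℓ) =
    line-pos-injective d (trans p∈ℓ (sym p'∈ℓ)) (case clusters-nested q∈w q∈w' of λ where
      (inj₁ w⊆w') → trans (linked-off-line d link p∈u y∈w p∈ℓ y∉ℓ)
                          (sym (linked-off-line d link' p'∈u' (w⊆w' y∈w) p'∈ℓ y∉ℓ))
      (inj₂ w'⊆w) → trans (linked-off-line d link p∈u (w'⊆w y'∈w') p∈ℓ y'∉ℓ)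
                          (sym (linked-off-line d link' p'∈u' y'∈w' p'∈ℓ y'∉ℓ)))

  data Cover (d : Direction) (p q : Square g) : Set where
    leavesˡ : ∀ {u v} → (u , v) ∈ E → InCluster p u → InCluster q v → LeavesLine d u (line d p) → Cover d p q
    leavesʳ : ∀ {u v} → (u , v) ∈ E → InCluster p u → InCluster q v → LeavesLine d v (line d q) → Cover d p q
    within  : ∀ {u v} → (u , v) ∈ E → InCluster p u → InCluster q v →
              WithinLine d u (line d p) → WithinLine d v (line d q) → Cover d p q

  cover : ∀ d {p q} → RookEdge p q → Cover d p q
  cover d {p} {q} p~q with (u , v) , uv∈E , p∈u , q∈v ← covers p q p~q
    with within-or-leaves d u (line d p) | within-or-leaves d v (line d q)
  ... | inj₂ leaves   | _             = leavesˡ uv∈E p∈u q∈v leaves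
  ... | inj₁ _        | inj₂ leaves   = leavesʳ uv∈E p∈u q∈v leaves
  ... | inj₁ within-u | inj₁ within-v = within uv∈E p∈u q∈v within-u within-v

  Code : Set
  Code = Fin (length E) ⊎ (Square g ⊎ Square g)

  code : ∀ {d p q} → Cover d p q → Code
  code {p = p} (leavesˡ _ _ _ _) = inj₂ (inj₁ p)
  code {q = q} (leavesʳ _ _ _ _) = inj₂ (inj₂ q)
  code (within uv∈E _ _ _ _)     = inj₁ (index uv∈E)

  code-injective : ∀ d {p q p' q'} → line d p ≡ line d q → line d p' ≡ line d q' →
                   Isolated d p → Isolated d q → (c : Cover d p q) (c' : Cover d p' q') →
                   code c ≡ code c' → p ≡ p' × q ≡ q'
  code-injective d p∥q p'∥q' _ _ (leavesˡ uv∈E p∈u q∈v leaves) (leavesˡ uv∈E' p∈u' q'∈v' leaves') refl =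
    refl , leaving-determines d (linked-sym (edge-linked uv∈E)) (linked-sym (edge-linked uv∈E'))
                          q∈v q'∈v' p∈u p∈u' (sym p∥q) (sym p'∥q') leaves leaves'
  code-injective d p∥q p'∥q' _ _ (leavesʳ uv∈E p∈u q∈v leaves) (leavesʳ uv∈E' p'∈u' q∈v' leaves') refl =
    leaving-determines d (edge-linked uv∈E) (edge-linked uv∈E') p∈u p'∈u' q∈v q∈v' p∥q p'∥q' leaves leaves' , refl
  code-injective d _ _ p-iso q-iso (within uv∈E p∈u q∈v within-u within-v) (within uv∈E' p'∈u q'∈v _ _) eq
    with refl ← ∈-index-injective uv∈E uv∈E' (Sum.inj₁-injective eq)
    = sym (p-iso p∈u within-u p'∈u) , sym (q-iso q∈v within-v q'∈v)
  code-injective _ _ _ _ _ (leavesˡ _ _ _ _)  (leavesʳ _ _ _ _)  ()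
  code-injective _ _ _ _ _ (leavesˡ _ _ _ _)  (within _ _ _ _ _) ()
  code-injective _ _ _ _ _ (leavesʳ _ _ _ _)  (leavesˡ _ _ _ _)  ()
  code-injective _ _ _ _ _ (leavesʳ _ _ _ _)  (within _ _ _ _ _) ()
  code-injective _ _ _ _ _ (within _ _ _ _ _) (leavesˡ _ _ _ _)  ()
  code-injective _ _ _ _ _ (within _ _ _ _ _) (leavesʳ _ _ _ _)  ()

  code↔Fin : Code ↔ Fin (length E + (g * g + g * g))
  code↔Fin = ↔-sym (((↔-refl ⊎-↔ (*↔× ⊎-↔ *↔×)) ↔-∘ (↔-refl ⊎-↔ +↔⊎)) ↔-∘ +↔⊎)

module Counting {g : ℕ} (T : TreeCompression g) where

  open TreeCompression T
  open Clusters T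
  open Covering T

  -- Kept opaque: unfolding the cluster search behind it makes type checking very slow.
  opaque
    orientation : Square g → Direction
    orientation = proj₁ ∘ isolated-direction

    oriented⇒isolated : ∀ {d p} → orientation p ≡ d → Isolated d p
    oriented⇒isolated {p = p} refl = proj₂ (isolated-direction p)

  weight : Direction → Fin g → ℕ
  weight d c = count (λ i → orientation (point d c i) ≟ᵈ d)

  weights-total : sum (weight row) + sum (weight col) ≡ g * g
  weights-total = begin
    sum (weight row) + sum (weight col)
      ≡⟨ cong (sum (weight row) +_) (∑-comm λ c r → indicator (orientation (r , c) ≟ᵈ col)) ⟩
    ∑[ r < g ] count (oriented? r row) + ∑[ r < g ] count (oriented? r col)
      ≡⟨ ∑-distrib-+ (λ r → count (oriented? r row)) (λ r → count (oriented? r col)) ⟨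
    ∑[ r < g ] (count (oriented? r row) + count (oriented? r col))
      ≡⟨ sum-cong-≗ (λ r → count-partition (oriented? r row) (oriented? r col) (indicator-row+col ∘ orientation ∘ (r ,_))) ⟩
    ∑[ r < g ] g
      ≡⟨ ∑-const g g ⟩
    g * g ∎
    where
    open ≡-Reasoning
    oriented? : ∀ r d c → Dec (orientation (r , c) ≡ d)
    oriented? r d c = orientation (r , c) ≟ᵈ d

  OrientedPair : Direction → Set
  OrientedPair d = Σ (Fin g) λ c → Fin (weight d c) × Fin (weight d c)

  oriented-pair↣code : ∀ d → OrientedPair d ↣ Code
  oriented-pair↣code d = mk↣ {to = code ∘ cover-pair} injective
    where
    oriented? : ∀ c i → Dec (orientation (point d c i) ≡ d)
    oriented? c i = orientation (point d c i) ≟ᵈ d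
    on-line : ∀ c → Fin (weight d c) → Square g
    on-line c k = point d c (select (oriented? c) k)
    collinear : ∀ c k l → line d (on-line c k) ≡ line d (on-line c l)
    collinear c k l = point-collinear d c _ _
    isolated : ∀ c k → Isolated d (on-line c k)
    isolated c k = oriented⇒isolated (select-satisfies (oriented? c) k)
    cover-pair : ((c , k , l) : OrientedPair d) → Cover d (on-line c k) (on-line c l)
    cover-pair (c , k , l) = cover d (same-line⇒rook d (collinear c k l))
    injective : ∀ {x y} → code (cover-pair x) ≡ code (cover-pair y) → x ≡ y
    injective {c , k , l} {c' , k' , l'} eq = on-line-≡
      (code-injective d (collinear c k l) (collinear c' k' l') (isolated c k) (isolated c l)
                      (cover-pair (c , k , l)) (cover-pair (c' , k' , l')) eq)
      where
      on-line-≡ : on-line c k ≡ on-line c' k' × on-line c l ≡ on-line c' l' → (c , k , l) ≡ (c' , k' , l')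
      on-line-≡ (p≡p' , q≡q') with refl , i≡i' ← point-injective d p≡p' | _ , j≡j' ← point-injective d q≡q' =
        cong (c ,_) (cong₂ _,_ (select-injective (oriented? c) i≡i') (select-injective (oriented? c) j≡j'))

  oriented-pairs-bound : ∀ d → ∑[ c < g ] (weight d c * weight d c) ≤ length E + (g * g + g * g)
  oriented-pairs-bound d = ↣⇒≤ (↔⇒↣ code↔Fin ↣-∘ (oriented-pair↣code d ↣-∘ (squares ↣-∘ ∑↣Σ _)))
    where
    squares : Σ (Fin g) (λ c → Fin (weight d c * weight d c)) ↣ OrientedPair d
    squares = congˡ {k = injection} (↔⇒↣ *↔×)

theorem2 : (g : ℕ) → 1 ≤ g → (T : TreeCompression g) →
    g ^ 3 ≤ 32 * numEdges T + 32 * g ^ 2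
theorem2 g _ T = ≤-trans (g³≤4K g K _ _ weights-total (line-bound row) (line-bound col))
                         (4[L+2g²]≤32L+32g² (numEdges T) g)
  where
  open Counting T
  K = numEdges T + (g * g + g * g)
  line-bound : ∀ d → 4 * (g * sum (weight d)) ≤ 4 * K + g * (g * g)
  line-bound d = ≤-trans (∑-4ma≤4a²+m² g (weight d)) (+-monoˡ-≤ _ (*-monoʳ-≤ 4 (oriented-pairs-bound d)))
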